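{- Let $n$ be a positive integer with $\gcd(n,6)=1$, and let $b\ge3$ be an integer such that $3\cdot2^b<n<3\cdot2^{b+1}$. Then $k=2^{b-2}$ is good.
   Context: $[\cdot]$ is the floor function. An integer $k$ is called good (relative to $n$) if: (i) $k=2^l$ for some integer $l\ge0$; (ii) $k<\frac{n}{6}$; (iii) $F(k):=\left(2n-2-2\left[\frac{3k-1}{3k}n\right]\right)k>\frac{n-1}{2}$. -}

module Defs where

open import Data.Nat using (ℕ; zero; suc; _+_; _*_; _∸_; _^_; _<_)
open import Data.Nat.DivMod using (_/_)
open import Data.Product using (Σ; _×_)
open import Relation.Binary.PropositionalEquality using (_≡_)

-- ⌊ (3k-1)/(3k) · n ⌋ = ⌊ (3k-1)·n / (3k) ⌋ for k ≥ 1.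
-- The k = 0 case is never used for good k (k = 2^l ≥ 1); we set it to 0.
floorTerm : ℕ → ℕ → ℕ
floorTerm zero    n = 0
floorTerm (suc j) n = ((3 * suc j ∸ 1) * n) / (3 * suc j)

-- F(k) = (2n - 2 - 2⌊(3k-1)n/(3k)⌋) k   (the inner quantity is ≥ 0 for n ≥ 1)
F : ℕ → ℕ → ℕ
F n k = (2 * n ∸ 2 ∸ 2 * floorTerm k n) * k

-- k is good relative to n:
--  (i) k = 2^l, (ii) k < n/6  ⇔  6k < n,  (iii) F(k) > (n-1)/2  ⇔  n - 1 < 2 F(k)
Good : ℕ → ℕ → Set
Good n k = Σ ℕ (λ l → k ≡ 2 ^ l) × (6 * k < n) × (n ∸ 1 < 2 * F n k)

module Submission where

open import Defs
open import Data.Nat using (ℕ; _+_; _*_; _^_; _<_; _≤_; _∸_)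
open import Data.Nat.GCD using (gcd)
open import Relation.Binary.PropositionalEquality using (_≡_)

open import Data.Nat using (zero; suc; s≤s)
open import Data.Nat.Properties
open import Data.Nat.DivMod using (_/_; m/n*n≤m)
open import Data.Nat.Solver using (module +-*-Solver)
open +-*-Solver using (solve; _:*_; con; _:=_)
open import Data.Product using (_,_)
open import Relation.Binary.PropositionalEquality using (refl; sym; cong; subst; module ≡-Reasoning)

-- Every power of two k with 12k < n is good; for k = 2^(b-2)
-- this is the hypothesis 3·2^b < n.  Conditions (i) and (ii) are immediate, so the work is (iii).
-- Write m = 3k, f = ⌊(m-1)n/m⌋ and d = n - f.  From f·m ≤ (m-1)·n we get
-- n ≤ m·d  (floor-deficit), and the factor of F is 2n - 2 - 2f = 2(d-1)
-- (F-factor), so F(k) = 2(d-1)k.  Now 12k < n ≤ 3kd forces d > 4, whence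
-- 3d ≤ 4(d-1) (three-le-four-pred) and n ≤ 3kd ≤ 4(d-1)k = 2F(k), which
-- gives n - 1 < 2F(k) (deficit-bound).

floor-deficit : ∀ p n f → f * suc p ≤ p * n → n ≤ suc p * (n ∸ f)
floor-deficit p n f f*[p+1]≤p*n = subst (n ≤_) (sym deficit) n≤
  where
  n≤ : n ≤ suc p * n ∸ suc p * f
  n≤ = m+n≤o⇒m≤o∸n n (subst (λ x → n + x ≤ suc p * n) (*-comm f (suc p))
                            (+-monoʳ-≤ n f*[p+1]≤p*n))
  deficit : suc p * (n ∸ f) ≡ suc p * n ∸ suc p * f
  deficit = *-distribˡ-∸ (suc p) n f

F-factor : ∀ n f → 2 * n ∸ 2 ∸ 2 * f ≡ 2 * (n ∸ f ∸ 1)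
F-factor n f = begin
  2 * n ∸ 2 ∸ 2 * f     ≡⟨ ∸-+-assoc (2 * n) 2 (2 * f) ⟩
  2 * n ∸ (2 + 2 * f)   ≡⟨ cong (2 * n ∸_) (+-comm 2 (2 * f)) ⟩
  2 * n ∸ (2 * f + 2)   ≡⟨ sym (∸-+-assoc (2 * n) (2 * f) 2) ⟩
  2 * n ∸ 2 * f ∸ 2     ≡⟨ cong (_∸ 2) (sym (*-distribˡ-∸ 2 n f)) ⟩
  2 * (n ∸ f) ∸ 2       ≡⟨ sym (*-distribˡ-∸ 2 (n ∸ f) 1) ⟩
  2 * (n ∸ f ∸ 1)       ∎
  where open ≡-Reasoning

three-le-four-pred : ∀ d → 4 ≤ d → 3 * d ≤ 4 * (d ∸ 1)
three-le-four-pred (suc c) (s≤s 3≤c) =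
  subst (_≤ 4 * c) (sym (*-suc 3 c)) (+-monoˡ-≤ (3 * c) 3≤c)

deficit-bound : ∀ k n d → 12 * k < n → n ≤ 3 * k * d → n ∸ 1 < 2 * (2 * (d ∸ 1) * k)
deficit-bound k (suc n) d 12k<n n≤3kd = begin-strict
  n                    <⟨ ≤-refl ⟩
  suc n                ≤⟨ n≤3kd ⟩
  3 * k * d            ≡⟨ solve 2 (λ k d → con 3 :* k :* d := con 3 :* d :* k) refl k d ⟩
  3 * d * k            ≤⟨ *-monoˡ-≤ k (three-le-four-pred d 4≤d) ⟩
  4 * (d ∸ 1) * k      ≡⟨ solve 2 (λ e k → con 4 :* e :* k := con 2 :* (con 2 :* e :* k)) refl (d ∸ 1) k ⟩
  2 * (2 * (d ∸ 1) * k) ∎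
  where
  open ≤-Reasoning
  12k≡3k*4 : 12 * k ≡ 3 * k * 4
  12k≡3k*4 = solve 1 (λ k → con 12 :* k := con 3 :* k :* con 4) refl k
  4≤d : 4 ≤ d
  4≤d = <⇒≤ (*-cancelˡ-< (3 * k) 4 d (subst (_< 3 * k * d) 12k≡3k*4 (<-≤-trans 12k<n n≤3kd)))

condition-iii : ∀ k n → 0 < k → 12 * k < n → n ∸ 1 < 2 * F n k
condition-iii (suc j) n _ 12k<n =
  subst (λ x → n ∸ 1 < 2 * (x * suc j)) (sym (F-factor n f))
        (deficit-bound (suc j) n (n ∸ f) 12k<n
          (floor-deficit p n f (m/n*n≤m (p * n) (3 * suc j))))
  where
  p : ℕ
  p = 3 * suc j ∸ 1
  f : ℕ
  f = floorTerm (suc j) n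

large-power-of-two-good : ∀ l n → 12 * 2 ^ l < n → Good n (2 ^ l)
large-power-of-two-good l n 12k<n =
  (l , refl) , ≤-<-trans (*-monoˡ-≤ (2 ^ l) (m≤m+n 6 6)) 12k<n
             , condition-iii (2 ^ l) n (m^n>0 2 l) 12k<n

lemma6 : (n b : ℕ) → 0 < n → gcd n 6 ≡ 1 → 3 ≤ b →
    3 * 2 ^ b < n → n < 3 * 2 ^ (b + 1) →
    Good n (2 ^ (b ∸ 2))
lemma6 n zero          _ _ ()            _ _
lemma6 n (suc zero)    _ _ (s≤s ())      _ _
lemma6 n (suc (suc c)) _ _ _ 3*2^b<n _ =
  large-power-of-two-good c n (subst (_< n) 3*2^b≡12*2^c 3*2^b<n)
  where
  3*2^b≡12*2^c : 3 * 2 ^ suc (suc c) ≡ 12 * 2 ^ c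
  3*2^b≡12*2^c = solve 1 (λ x → con 3 :* (con 2 :* (con 2 :* x)) := con 12 :* x) refl (2 ^ c)
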